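{- Let $K$ be dyadic and $E/K$ a ramified quadratic field extension. Let $L$ be a hermitian lattice over $E$ and let $(v,u_1)$, $(v,u_2)$ be hyperbolic pairs splitting $L$ with $\langle v,u_1\rangle=\langle v,u_2\rangle$. Then there exists a rescaled Eichler isometry $\varphi\in X(L)$ such that $\varphi(u_1)=u_2$ and $\varphi(v)=v$.
   Context: $K$ is a non-Archimedean local field of characteristic zero; dyadic means $2$ is not a unit in its valuation ring. $E$ has ring of integers $\mathcal{O}$, involution $x\mapsto\bar x$, trace $\mathrm{Tr}(\alpha)=\alpha+\bar\alpha$. A hermitian lattice is a finitely generated $\mathcal{O}$-submodule $L$ of a finitely generated free $E$-module $V$ with $\langle\cdot,\cdot\rangle:V\times V\to E$, $E$-linear in the first argument, $\langle x,y\rangle=\overline{\langle y,x\rangle}$; non-degenerate. $U(L)=\{f\in U(V):f(L)=L\}$. A hyperbolic pair splitting $L$ is a pair $(u,v)$ of linearly independent elements of $L$ with $\langle u,u\rangle=\langle v,v\rangle=0$ and $L=P\perp P^\perp$, $P=\mathcal{O}u\oplus\mathcal{O}v$, $P^\perp$ its orthogonal complement in $L$. For such a pair, $y\in P^\perp$ with $\langle L,y\rangle\subseteq\langle u,v\rangle\mathcal{O}$ and $\mu\in\mathcal{O}$ with $\mathrm{Tr}(\mu\langle u,v\rangle)=-\langle y,y\rangle$, the rescaled Eichler isometry is $E^\mu_y(x)=x+\frac{\langle x,u\rangle}{\langle v,u\rangle}y+\Big(\frac{\mu\langle x,u\rangle}{\langle v,u\rangle}-\frac{\langle x,y\rangle}{\langle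 u,v\rangle}\Big)u\in U(L)$. $X(L)$ is the subgroup of $U(L)$ generated by symmetries lying in $U(L)$ (maps $S_{s,\sigma}(x)=x-\langle x,s\rangle\sigma^{ -1}s$ with $\langle s,s\rangle=\mathrm{Tr}(\sigma)$) and all rescaled Eichler isometries of $L$. -}

module Defs where

open import Level using (Level; _⊔_) renaming (suc to lsuc)
open import Algebra.Bundles using (CommutativeRing)
open import Data.Nat as ℕ using (ℕ; zero; suc)
open import Data.Integer as ℤ using (ℤ; +_)
open import Data.Fin using (Fin; zero; suc)
open import Data.Product using (Σ; ∃; ∃-syntax; _×_; _,_)
open import Data.Sum using (_⊎_)
open import Relation.Nullary using (¬_)
open import Relation.Binary.PropositionalEquality using (_≡_)

-- Setting: E a field (commutative ring + field axioms) with a nontrivial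
-- involution conj; K is the fixed field of conj, so E/K is a quadratic
-- extension and conj is its nontrivial automorphism.  E carries a
-- normalised discrete valuation (val, meaningful only on nonzero elements)
-- for which E is complete with finite residue field and E has
-- characteristic 0; hence K (closed in E) is a non-Archimedean local field
-- of characteristic zero and O = {x | val x ≥ 0} is the ring of integers
-- of E.

module _ {c ℓ} (R : CommutativeRing c ℓ) where
  open CommutativeRing R
  natR : ℕ → Carrier
  natR zero    = 0#
  natR (suc n) = 1# + natR n

record LocalQuadSetting c ℓ : Set (lsuc (c ⊔ ℓ)) where
  field
    Efield : CommutativeRing c ℓ
  open CommutativeRing Efield public
  field
    1≉0        : ¬ (1# ≈ 0#)
    inv        : Carrier → Carrier
    inverseʳ   : ∀ x → ¬ (x ≈ 0#) → (x * inv x) ≈ 1#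
    char0      : ∀ n → ¬ (natR Efield (suc n) ≈ 0#)
    conj       : Carrier → Carrier
    conj-cong  : ∀ {x y} → x ≈ y → conj x ≈ conj y
    conj-+     : ∀ x y → conj (x + y) ≈ (conj x + conj y)
    conj-*     : ∀ x y → conj (x * y) ≈ (conj x * conj y)
    conj-conj  : ∀ x → conj (conj x) ≈ x
    conj-nontrivial : ∃[ x ] ¬ (conj x ≈ x)
    -- normalised discrete valuation on E (values on 0 are irrelevant)
    val        : Carrier → ℤ
    val-cong   : ∀ {x y} → ¬ (x ≈ 0#) → x ≈ y → val x ≡ val y
    val-*      : ∀ x y → ¬ (x ≈ 0#) → ¬ (y ≈ 0#) → val (x * y) ≡ (val x ℤ.+ val y)
    val-+      : ∀ x y → ¬ (x ≈ 0#) → ¬ (y ≈ 0#) → ¬ ((x + y) ≈ 0#) →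
                 (val x ℤ.⊓ val y) ℤ.≤ val (x + y)
    val-normalised : ∃[ π ] (¬ (π ≈ 0#) × val π ≡ + 1)

  -- x ∈ π^k O
  Small : ℕ → Carrier → Set ℓ
  Small k x = (x ≈ 0#) ⊎ ((¬ (x ≈ 0#)) × (+ k ℤ.≤ val x))

  Integral : Carrier → Set ℓ
  Integral = Small 0

  InK : Carrier → Set ℓ
  InK x = conj x ≈ x

  Cauchy : (ℕ → Carrier) → Set ℓ
  Cauchy s = ∀ k → ∃[ N ] (∀ m n → N ℕ.≤ m → N ℕ.≤ n → Small k (s m - s n))

  ConvergesTo : (ℕ → Carrier) → Carrier → Set ℓ
  ConvergesTo s l = ∀ k → ∃[ N ] (∀ n → N ℕ.≤ n → Small k (s n - l))

  field
    complete        : ∀ s → Cauchy s → ∃[ l ] ConvergesTo s l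
    residue-finite  : ∃[ k ] Σ (Fin k → Carrier) λ r →
                        (∀ i → Integral (r i)) ×
                        (∀ x → Integral x → ∃[ i ] Small 1 (x - r i))

  Tr : Carrier → Carrier
  Tr a = a + conj a

-- K dyadic: 2 is not a unit of the valuation ring O_K = O ∩ K.
Dyadic : ∀ {c ℓ} → LocalQuadSetting c ℓ → Set (c ⊔ ℓ)
Dyadic S = ¬ (∃[ y ] (InK y × Integral y × ((1# + 1#) * y) ≈ 1#))
  where open LocalQuadSetting S

-- E/K ramified: ramification index e = [val(E×) : val(K×)] = 2,
-- i.e. val(K×) = 2ℤ (val is normalised, val(E×) = ℤ).
Ramified : ∀ {c ℓ} → LocalQuadSetting c ℓ → Set (c ⊔ ℓ)
Ramified S =
  (∀ a → InK a → ¬ (a ≈ 0#) → ∃[ z ] (val a ≡ (z ℤ.+ z))) ×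
  (∃[ a ] (InK a × ¬ (a ≈ 0#) × val a ≡ + 2))
  where open LocalQuadSetting S

module Hermitian {c ℓ} (S : LocalQuadSetting c ℓ) where
  open LocalQuadSetting S hiding (zero)

  V : ℕ → Set c
  V n = Fin n → Carrier

  module _ {n : ℕ} where
    infixl 6 _+ᵥ_
    infixr 7 _·ᵥ_
    infix 4 _≈ᵥ_

    _≈ᵥ_ : V n → V n → Set ℓ
    x ≈ᵥ y = ∀ i → x i ≈ y i

    _+ᵥ_ : V n → V n → V n
    (x +ᵥ y) i = x i + y i

    _·ᵥ_ : Carrier → V n → V n
    (a ·ᵥ x) i = a * x i

    0ᵥ : V n
    0ᵥ i = 0#

    sumᵥ : ∀ {m} → (Fin m → V n) → V n
    sumᵥ {zero}  w = 0ᵥ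
    sumᵥ {suc m} w = w zero +ᵥ sumᵥ (λ i → w (suc i))


  record HForm (n : ℕ) : Set (c ⊔ ℓ) where
    field
      ⟨_,_⟩    : V n → V n → Carrier
      ⟨⟩-cong  : ∀ {x x′ y y′} → x ≈ᵥ x′ → y ≈ᵥ y′ → ⟨ x , y ⟩ ≈ ⟨ x′ , y′ ⟩
      ⟨⟩-+     : ∀ x y z → ⟨ x +ᵥ y , z ⟩ ≈ (⟨ x , z ⟩ + ⟨ y , z ⟩)
      ⟨⟩-·     : ∀ a x y → ⟨ a ·ᵥ x , y ⟩ ≈ (a * ⟨ x , y ⟩)
      ⟨⟩-herm  : ∀ x y → ⟨ x , y ⟩ ≈ conj ⟨ y , x ⟩
      nondeg   : ∀ x → (∀ y → ⟨ x , y ⟩ ≈ 0#) → x ≈ᵥ 0ᵥ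

  Span : ∀ {n m} → (Fin m → V n) → V n → Set (c ⊔ ℓ)
  Span {n} {m} g x = Σ (Fin m → Carrier) λ a → ((∀ (i : Fin m) → Integral (a i)) × x ≈ᵥ sumᵥ (λ i → a i ·ᵥ g i))

  module Lattice {n m : ℕ} (H : HForm n) (g : Fin m → V n) where
    open HForm H

    InL : V n → Set (c ⊔ ℓ)
    InL = Span g

    InP : V n → V n → V n → Set (c ⊔ ℓ)
    InP u v x = ∃[ a ] ∃[ b ] (Integral a × Integral b × x ≈ᵥ a ·ᵥ u +ᵥ b ·ᵥ v)

    InP⊥ : V n → V n → V n → Set (c ⊔ ℓ)
    InP⊥ u v x = InL x × (∀ p → InP u v p → ⟨ x , p ⟩ ≈ 0#)

    record HypPair (u v : V n) : Set (c ⊔ ℓ) where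
      field
        u∈L      : InL u
        v∈L      : InL v
        linIndep : ∀ a b → a ·ᵥ u +ᵥ b ·ᵥ v ≈ᵥ 0ᵥ → (a ≈ 0#) × (b ≈ 0#)
        u-iso    : ⟨ u , u ⟩ ≈ 0#
        v-iso    : ⟨ v , v ⟩ ≈ 0#
        split    : ∀ x → InL x → ∃[ p ] ∃[ q ] (InP u v p × InP⊥ u v q × x ≈ᵥ p +ᵥ q)
        direct   : ∀ x → InP u v x → InP⊥ u v x → x ≈ᵥ 0ᵥ

    record InU (f : V n → V n) : Set (c ⊔ ℓ) where
      field
        f-cong  : ∀ {x y} → x ≈ᵥ y → f x ≈ᵥ f y
        f-+     : ∀ x y → f (x +ᵥ y) ≈ᵥ f x +ᵥ f y
        f-·     : ∀ a x → f (a ·ᵥ x) ≈ᵥ a ·ᵥ f x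
        f-inv   : Σ (V n → V n) λ h → ((∀ x → f (h x) ≈ᵥ x) × (∀ x → h (f x) ≈ᵥ x))
        f-isom  : ∀ x y → ⟨ f x , f y ⟩ ≈ ⟨ x , y ⟩
        f-L⊆L   : ∀ x → InL x → InL (f x)
        f-L⊇L   : ∀ x → InL x → ∃[ z ] (InL z × f z ≈ᵥ x)

    IsSymmetry : (V n → V n) → Set (c ⊔ ℓ)
    IsSymmetry f = ∃[ s ] ∃[ σ ] (¬ (σ ≈ 0#) × ⟨ s , s ⟩ ≈ Tr σ ×
                     (∀ x → f x ≈ᵥ x +ᵥ (- (⟨ x , s ⟩ * inv σ)) ·ᵥ s))

    IsRescaledEichler : (V n → V n) → Set (c ⊔ ℓ)
    IsRescaledEichler f =
      ∃[ u ] ∃[ v ] ∃[ y ] ∃[ μ ]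
        ( HypPair u v
        × InP⊥ u v y
        × (∀ x → InL x → ∃[ o ] (Integral o × ⟨ x , y ⟩ ≈ (⟨ u , v ⟩ * o)))
        × Integral μ
        × Tr (μ * ⟨ u , v ⟩) ≈ (- ⟨ y , y ⟩)
        × (∀ x → f x ≈ᵥ x +ᵥ (⟨ x , u ⟩ * inv ⟨ v , u ⟩) ·ᵥ y
                        +ᵥ ((μ * ⟨ x , u ⟩) * inv ⟨ v , u ⟩
                             - ⟨ x , y ⟩ * inv ⟨ u , v ⟩) ·ᵥ u))

    -- X(L): subgroup of U(L) generated by symmetries in U(L) and all
    -- rescaled Eichler isometries of L (maps identified pointwise)
    data InX : (V n → V n) → Set (c ⊔ ℓ) where
      gen-sym  : ∀ {f} → IsSymmetry f → InU f → InX f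
      gen-eich : ∀ {f} → IsRescaledEichler f → InX f
      x-id     : ∀ {f} → (∀ x → f x ≈ᵥ x) → InX f
      x-comp   : ∀ {f g h} → InX g → InX h → (∀ x → f x ≈ᵥ g (h x)) → InX f
      x-inv    : ∀ {f g} → InX g → (∀ x → f (g x) ≈ᵥ x) → (∀ x → g (f x) ≈ᵥ x) → InX f

-- Split u₂ along the pair (v , u₁): u₂ = a v + b u₁ + q with q ⊥ v, u₁.
-- Pairing with v and ⟨v , u₁⟩ = ⟨v , u₂⟩ force b = 1, and ⟨u₂ , u₂⟩ = 0
-- becomes Tr (a ⟨v , u₁⟩) = - ⟨q , q⟩.  Moreover ⟨L , q⟩ ⊆ ⟨v , u₁⟩ O,
-- because on the orthogonal complement of (v , u₁) pairing with q is
-- pairing with u₂, and ⟨L , u₂⟩ ⊆ ⟨v , u₂⟩ O as (v , u₂) splits L.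
-- Hence E^a_q (for the pair (v , u₁)) is a rescaled Eichler isometry; it
-- fixes v and sends u₁ to a v + u₁ + q = u₂.
module Submission where

open import Defs
open import Algebra.Bundles using (AbelianGroup)
import Algebra.Properties.Group as GroupProperties
open import Data.Nat using (ℕ)
open import Data.Fin using (Fin)
open import Data.Product using (∃-syntax; _×_; _,_; proj₁; proj₂)
open import Data.Sum using (inj₁; inj₂)
import Data.Integer as ℤ
import Data.Integer.Properties as ℤ
import Relation.Binary.PropositionalEquality as Eq
import Relation.Binary.Reasoning.Setoid as SetoidReasoning
open import Relation.Nullary using (¬_)

module EichlerProperties {c ℓ} (S : LocalQuadSetting c ℓ) where
  open LocalQuadSetting S hiding (zero)
  open Hermitian S
  open SetoidReasoning setoid
  open GroupProperties +-group using (identityˡ-unique; inverseˡ-unique; ε⁻¹≈ε)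

  conj-0 : conj 0# ≈ 0#
  conj-0 = identityˡ-unique (conj 0#) (conj 0#)
             (trans (sym (conj-+ 0# 0#)) (conj-cong (+-identityˡ 0#)))

  val-1 : val 1# Eq.≡ ℤ.+ 0
  val-1 = ℤ-identityˡ-unique (val 1#) (val 1#) (Eq.sym val-1*1)
    where
    open GroupProperties (AbelianGroup.group ℤ.+-0-abelianGroup)
      using () renaming (identityˡ-unique to ℤ-identityˡ-unique)
    val-1*1 : val 1# Eq.≡ val 1# ℤ.+ val 1#
    val-1*1 = Eq.trans (val-cong 1≉0 (sym (*-identityˡ 1#))) (val-* 1# 1# 1≉0 1≉0)

  integral-0 : Integral 0#
  integral-0 = inj₁ refl

  integral-1 : Integral 1#
  integral-1 = inj₂ (1≉0 , ℤ.≤-reflexive (Eq.sym val-1))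

  x≈0⇒x*y≈0 : ∀ {x} y → x ≈ 0# → x * y ≈ 0#
  x≈0⇒x*y≈0 y x≈0 = trans (*-congʳ x≈0) (zeroˡ y)

  x≈0⇒y*x≈0 : ∀ {x} y → x ≈ 0# → y * x ≈ 0#
  x≈0⇒y*x≈0 y x≈0 = trans (*-congˡ x≈0) (zeroʳ y)

  *-cancel-≈1 : ∀ {b e} → ¬ (e ≈ 0#) → b * e ≈ e → b ≈ 1#
  *-cancel-≈1 {b} {e} e≉0 be≈e = begin
    b                ≈⟨ *-identityʳ b ⟨
    b * 1#           ≈⟨ *-congˡ (inverseʳ e e≉0) ⟨
    b * (e * inv e)  ≈⟨ *-assoc b e (inv e) ⟨
    (b * e) * inv e  ≈⟨ *-congʳ be≈e ⟩
    e * inv e        ≈⟨ inverseʳ e e≉0 ⟩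
    1#               ∎

  module Form {n : ℕ} (H : HForm n) where
    open HForm H

    ⟨⟩-+ʳ : ∀ x y z → ⟨ x , y +ᵥ z ⟩ ≈ ⟨ x , y ⟩ + ⟨ x , z ⟩
    ⟨⟩-+ʳ x y z = begin
      ⟨ x , y +ᵥ z ⟩                   ≈⟨ ⟨⟩-herm x (y +ᵥ z) ⟩
      conj ⟨ y +ᵥ z , x ⟩              ≈⟨ conj-cong (⟨⟩-+ y z x) ⟩
      conj (⟨ y , x ⟩ + ⟨ z , x ⟩)     ≈⟨ conj-+ _ _ ⟩
      conj ⟨ y , x ⟩ + conj ⟨ z , x ⟩  ≈⟨ +-cong (⟨⟩-herm x y) (⟨⟩-herm x z) ⟨
      ⟨ x , y ⟩ + ⟨ x , z ⟩            ∎

    ⟨⟩-linearˡ : ∀ a b x y z → ⟨ a ·ᵥ x +ᵥ b ·ᵥ y , z ⟩ ≈ a * ⟨ x , z ⟩ + b * ⟨ y , z ⟩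
    ⟨⟩-linearˡ a b x y z = trans (⟨⟩-+ _ _ z) (+-cong (⟨⟩-· a x z) (⟨⟩-· b y z))

    ⊥-sym : ∀ {x y} → ⟨ x , y ⟩ ≈ 0# → ⟨ y , x ⟩ ≈ 0#
    ⊥-sym {x} {y} x⊥y = trans (⟨⟩-herm y x) (trans (conj-cong x⊥y) conj-0)

  module Pairs {n m : ℕ} (H : HForm n) (g : Fin m → V n) where
    open HForm H
    open Lattice H g
    open Form H

    1·u+0·v≈u : ∀ (u v : V n) → 1# ·ᵥ u +ᵥ 0# ·ᵥ v ≈ᵥ u
    1·u+0·v≈u u v i = trans (+-cong (*-identityˡ (u i)) (zeroˡ (v i))) (+-identityʳ (u i))

    0·u+1·v≈v : ∀ (u v : V n) → 0# ·ᵥ u +ᵥ 1# ·ᵥ v ≈ᵥ v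
    0·u+1·v≈v u v i = trans (+-cong (zeroˡ (u i)) (*-identityˡ (v i))) (+-identityˡ (v i))

    InP-left : ∀ u v → InP u v u
    InP-left u v = 1# , 0# , integral-1 , integral-0 , λ i → sym (1·u+0·v≈u u v i)

    InP-right : ∀ u v → InP u v v
    InP-right u v = 0# , 1# , integral-0 , integral-1 , λ i → sym (0·u+1·v≈v u v i)

    InP⊥⇒⊥left : ∀ {u v q} → InP⊥ u v q → ⟨ q , u ⟩ ≈ 0#
    InP⊥⇒⊥left {u} {v} (_ , q⊥P) = q⊥P u (InP-left u v)

    InP⊥⇒⊥right : ∀ {u v q} → InP⊥ u v q → ⟨ q , v ⟩ ≈ 0#
    InP⊥⇒⊥right {u} {v} (_ , q⊥P) = q⊥P v (InP-right u v)

    module _ {u v : V n} (h : HypPair u v) where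
      open HypPair h

      -- If ⟨v , u⟩ vanished, u would lie in P ∩ P⊥ = 0.
      ⟨v,u⟩≉0 : ¬ (⟨ v , u ⟩ ≈ 0#)
      ⟨v,u⟩≉0 ⟨v,u⟩≈0 = 1≉0 (proj₁ (linIndep 1# 0# 1·u+0·v≈0))
        where
        ⟨P,u⟩≈0 : ∀ p → InP u v p → ⟨ p , u ⟩ ≈ 0#
        ⟨P,u⟩≈0 p (a , b , _ , _ , p≈) = begin
          ⟨ p , u ⟩                        ≈⟨ ⟨⟩-cong p≈ (λ _ → refl) ⟩
          ⟨ a ·ᵥ u +ᵥ b ·ᵥ v , u ⟩         ≈⟨ ⟨⟩-linearˡ a b u v u ⟩
          a * ⟨ u , u ⟩ + b * ⟨ v , u ⟩    ≈⟨ +-cong (x≈0⇒y*x≈0 a u-iso) (x≈0⇒y*x≈0 b ⟨v,u⟩≈0) ⟩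
          0# + 0#                          ≈⟨ +-identityˡ 0# ⟩
          0#                               ∎
        u≈0 : u ≈ᵥ 0ᵥ
        u≈0 = direct u (InP-left u v) (u∈L , λ p p∈P → ⊥-sym (⟨P,u⟩≈0 p p∈P))
        1·u+0·v≈0 : 1# ·ᵥ u +ᵥ 0# ·ᵥ v ≈ᵥ 0ᵥ
        1·u+0·v≈0 i = trans (1·u+0·v≈u u v i) (u≈0 i)

      ⟨L,v⟩⊆⟨u,v⟩O : ∀ x → InL x → ∃[ o ] (Integral o × ⟨ x , v ⟩ ≈ ⟨ u , v ⟩ * o)
      ⟨L,v⟩⊆⟨u,v⟩O x x∈L with split x x∈L
      ... | p , r , (α , β , iα , _ , p≈) , r∈P⊥ , x≈ = α , iα , (begin
        ⟨ x , v ⟩                        ≈⟨ ⟨⟩-cong x≈ (λ _ → refl) ⟩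
        ⟨ p +ᵥ r , v ⟩                   ≈⟨ ⟨⟩-+ p r v ⟩
        ⟨ p , v ⟩ + ⟨ r , v ⟩            ≈⟨ +-cong (⟨⟩-cong p≈ (λ _ → refl)) (InP⊥⇒⊥right r∈P⊥) ⟩
        ⟨ α ·ᵥ u +ᵥ β ·ᵥ v , v ⟩ + 0#    ≈⟨ +-identityʳ _ ⟩
        ⟨ α ·ᵥ u +ᵥ β ·ᵥ v , v ⟩         ≈⟨ ⟨⟩-linearˡ α β u v v ⟩
        α * ⟨ u , v ⟩ + β * ⟨ v , v ⟩    ≈⟨ +-congˡ (x≈0⇒y*x≈0 β v-iso) ⟩
        α * ⟨ u , v ⟩ + 0#               ≈⟨ +-identityʳ _ ⟩
        α * ⟨ u , v ⟩                    ≈⟨ *-comm α _ ⟩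
        ⟨ u , v ⟩ * α                    ∎)

    eichler : (u v y : V n) (μ : Carrier) → V n → V n
    eichler u v y μ x = x +ᵥ (⟨ x , u ⟩ * inv ⟨ v , u ⟩) ·ᵥ y
                          +ᵥ ((μ * ⟨ x , u ⟩) * inv ⟨ v , u ⟩ - ⟨ x , y ⟩ * inv ⟨ u , v ⟩) ·ᵥ u

    eichler-isRescaledEichler : ∀ {u v y μ} → HypPair u v → InP⊥ u v y →
      (∀ x → InL x → ∃[ o ] (Integral o × ⟨ x , y ⟩ ≈ ⟨ u , v ⟩ * o)) →
      Integral μ → Tr (μ * ⟨ u , v ⟩) ≈ - ⟨ y , y ⟩ →
      IsRescaledEichler (eichler u v y μ)
    eichler-isRescaledEichler {u} {v} {y} {μ} h y∈P⊥ ⟨L,y⟩ iμ tr =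
      u , v , y , μ , h , y∈P⊥ , ⟨L,y⟩ , iμ , tr , λ _ _ → refl

    eichler-fixes-left : ∀ {u v y} μ → ⟨ u , u ⟩ ≈ 0# → ⟨ u , y ⟩ ≈ 0# →
                         eichler u v y μ u ≈ᵥ u
    eichler-fixes-left {u} {v} {y} μ u-iso u⊥y i = begin
      (u i + (⟨ u , u ⟩ * inv ⟨ v , u ⟩) * y i)
        + ((μ * ⟨ u , u ⟩) * inv ⟨ v , u ⟩ - ⟨ u , y ⟩ * inv ⟨ u , v ⟩) * u i
          ≈⟨ +-cong (+-congˡ (x≈0⇒x*y≈0 _ (x≈0⇒x*y≈0 _ u-iso)))
                    (x≈0⇒x*y≈0 _ (trans (+-cong (x≈0⇒x*y≈0 _ (x≈0⇒y*x≈0 μ u-iso))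
                                                (trans (-‿cong (x≈0⇒x*y≈0 _ u⊥y)) ε⁻¹≈ε))
                                        (+-identityʳ 0#))) ⟩
      (u i + 0#) + 0#  ≈⟨ +-identityʳ _ ⟩
      u i + 0#         ≈⟨ +-identityʳ (u i) ⟩
      u i              ∎

    eichler-moves-right : ∀ {u v y} μ → ¬ (⟨ v , u ⟩ ≈ 0#) → ⟨ v , y ⟩ ≈ 0# →
                          eichler u v y μ v ≈ᵥ μ ·ᵥ u +ᵥ v +ᵥ y
    eichler-moves-right {u} {v} {y} μ ⟨v,u⟩≉0 v⊥y i = begin
      (v i + (⟨ v , u ⟩ * inv ⟨ v , u ⟩) * y i)
        + ((μ * ⟨ v , u ⟩) * inv ⟨ v , u ⟩ - ⟨ v , y ⟩ * inv ⟨ u , v ⟩) * u i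
          ≈⟨ +-cong (+-congˡ (trans (*-congʳ unit) (*-identityˡ (y i))))
                    (*-congʳ (+-cong (trans (*-assoc μ _ _) (trans (*-congˡ unit) (*-identityʳ μ)))
                                     (trans (-‿cong (x≈0⇒x*y≈0 _ v⊥y)) ε⁻¹≈ε))) ⟩
      (v i + y i) + (μ + 0#) * u i  ≈⟨ +-comm _ _ ⟩
      (μ + 0#) * u i + (v i + y i)  ≈⟨ +-congʳ (*-congʳ (+-identityʳ μ)) ⟩
      μ * u i + (v i + y i)         ≈⟨ +-assoc _ _ _ ⟨
      (μ * u i + v i) + y i         ∎
      where
      unit : ⟨ v , u ⟩ * inv ⟨ v , u ⟩ ≈ 1#
      unit = inverseʳ _ ⟨v,u⟩≉0

    module SharedPartner {u v w : V n} (huv : HypPair u v) (huw : HypPair u w)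
                         (⟨u,v⟩≈⟨u,w⟩ : ⟨ u , v ⟩ ≈ ⟨ u , w ⟩) where

      ⟨w,u⟩≈⟨v,u⟩ : ⟨ w , u ⟩ ≈ ⟨ v , u ⟩
      ⟨w,u⟩≈⟨v,u⟩ = trans (⟨⟩-herm w u) (trans (conj-cong (sym ⟨u,v⟩≈⟨u,w⟩)) (sym (⟨⟩-herm v u)))

      decomposition : ∃[ a ] ∃[ q ] (Integral a × InP⊥ u v q × w ≈ᵥ a ·ᵥ u +ᵥ v +ᵥ q)
      decomposition with HypPair.split huv w (HypPair.v∈L huw)
      ... | p , q , (a , b , ia , _ , p≈) , q∈P⊥ , w≈ = a , q , ia , q∈P⊥ , w≈au+v+q
        where
        ⟨w,u⟩≈b⟨v,u⟩ : ⟨ w , u ⟩ ≈ b * ⟨ v , u ⟩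
        ⟨w,u⟩≈b⟨v,u⟩ = begin
          ⟨ w , u ⟩                                 ≈⟨ ⟨⟩-cong (λ i → trans (w≈ i) (+-congʳ (p≈ i))) (λ _ → refl) ⟩
          ⟨ a ·ᵥ u +ᵥ b ·ᵥ v +ᵥ q , u ⟩             ≈⟨ ⟨⟩-+ _ q u ⟩
          ⟨ a ·ᵥ u +ᵥ b ·ᵥ v , u ⟩ + ⟨ q , u ⟩      ≈⟨ +-cong (⟨⟩-linearˡ a b u v u) (InP⊥⇒⊥left q∈P⊥) ⟩
          (a * ⟨ u , u ⟩ + b * ⟨ v , u ⟩) + 0#      ≈⟨ +-identityʳ _ ⟩
          a * ⟨ u , u ⟩ + b * ⟨ v , u ⟩             ≈⟨ +-congʳ (x≈0⇒y*x≈0 a (HypPair.u-iso huv)) ⟩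
          0# + b * ⟨ v , u ⟩                        ≈⟨ +-identityˡ _ ⟩
          b * ⟨ v , u ⟩                             ∎
        b≈1 : b ≈ 1#
        b≈1 = *-cancel-≈1 (⟨v,u⟩≉0 huv) (trans (sym ⟨w,u⟩≈b⟨v,u⟩) ⟨w,u⟩≈⟨v,u⟩)
        w≈au+v+q : w ≈ᵥ a ·ᵥ u +ᵥ v +ᵥ q
        w≈au+v+q i = trans (w≈ i) (+-congʳ (trans (p≈ i) (+-congˡ (trans (*-congʳ b≈1) (*-identityˡ (v i))))))

      module _ {a : Carrier} {q : V n} (ia : Integral a) (q∈P⊥ : InP⊥ u v q)
               (w≈ : w ≈ᵥ a ·ᵥ u +ᵥ v +ᵥ q) where

        p₀ : V n
        p₀ = a ·ᵥ u +ᵥ v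

        p₀∈P : InP u v p₀
        p₀∈P = a , 1# , ia , integral-1 , λ i → +-congˡ (sym (*-identityˡ (v i)))

        q⊥p₀ : ⟨ q , p₀ ⟩ ≈ 0#
        q⊥p₀ = proj₂ q∈P⊥ p₀ p₀∈P

        ⟨p₀,z⟩ : ∀ z → ⟨ p₀ , z ⟩ ≈ a * ⟨ u , z ⟩ + ⟨ v , z ⟩
        ⟨p₀,z⟩ z = trans (⟨⟩-+ _ v z) (+-congʳ (⟨⟩-· a u z))

        ⟨p₀,p₀⟩ : ⟨ p₀ , p₀ ⟩ ≈ Tr (a * ⟨ u , v ⟩)
        ⟨p₀,p₀⟩ = begin
          ⟨ p₀ , p₀ ⟩                            ≈⟨ ⟨p₀,z⟩ p₀ ⟩
          a * ⟨ u , p₀ ⟩ + ⟨ v , p₀ ⟩            ≈⟨ +-cong (*-congˡ ⟨u,p₀⟩) (⟨⟩-herm v p₀) ⟩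
          a * ⟨ u , v ⟩ + conj ⟨ p₀ , v ⟩        ≈⟨ +-congˡ (conj-cong ⟨p₀,v⟩) ⟩
          a * ⟨ u , v ⟩ + conj (a * ⟨ u , v ⟩)   ∎
          where
          ⟨p₀,v⟩ : ⟨ p₀ , v ⟩ ≈ a * ⟨ u , v ⟩
          ⟨p₀,v⟩ = trans (⟨p₀,z⟩ v) (trans (+-congˡ (HypPair.v-iso huv)) (+-identityʳ _))
          ⟨p₀,u⟩ : ⟨ p₀ , u ⟩ ≈ ⟨ v , u ⟩
          ⟨p₀,u⟩ = trans (⟨p₀,z⟩ u)
                     (trans (+-congʳ (x≈0⇒y*x≈0 a (HypPair.u-iso huv))) (+-identityˡ _))
          ⟨u,p₀⟩ : ⟨ u , p₀ ⟩ ≈ ⟨ u , v ⟩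
          ⟨u,p₀⟩ = trans (⟨⟩-herm u p₀) (trans (conj-cong ⟨p₀,u⟩) (sym (⟨⟩-herm u v)))

        trace-condition : Tr (a * ⟨ u , v ⟩) ≈ - ⟨ q , q ⟩
        trace-condition = inverseˡ-unique _ _ (begin
          Tr (a * ⟨ u , v ⟩) + ⟨ q , q ⟩                     ≈⟨ +-cong (+-identityʳ _) (+-identityˡ _) ⟨
          (Tr (a * ⟨ u , v ⟩) + 0#) + (0# + ⟨ q , q ⟩)       ≈⟨ +-cong (+-cong ⟨p₀,p₀⟩ (⊥-sym q⊥p₀)) (+-congʳ q⊥p₀) ⟨
          (⟨ p₀ , p₀ ⟩ + ⟨ p₀ , q ⟩) + (⟨ q , p₀ ⟩ + ⟨ q , q ⟩)  ≈⟨ +-cong (⟨⟩-+ʳ p₀ p₀ q) (⟨⟩-+ʳ q p₀ q) ⟨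
          ⟨ p₀ , p₀ +ᵥ q ⟩ + ⟨ q , p₀ +ᵥ q ⟩                  ≈⟨ ⟨⟩-+ p₀ q (p₀ +ᵥ q) ⟨
          ⟨ p₀ +ᵥ q , p₀ +ᵥ q ⟩                              ≈⟨ ⟨⟩-cong w≈ w≈ ⟨
          ⟨ w , w ⟩                                          ≈⟨ HypPair.v-iso huw ⟩
          0#                                                 ∎)

        ⟨L,q⟩⊆⟨u,v⟩O : ∀ x → InL x → ∃[ o ] (Integral o × ⟨ x , q ⟩ ≈ ⟨ u , v ⟩ * o)
        ⟨L,q⟩⊆⟨u,v⟩O x x∈L with HypPair.split huv x x∈L
        ... | p , r , p∈P , (r∈L , r⊥P) , x≈ with ⟨L,v⟩⊆⟨u,v⟩O huw r r∈L
        ... | o , io , ⟨r,w⟩≈ = o , io , (begin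
          ⟨ x , q ⟩                  ≈⟨ ⟨⟩-cong x≈ (λ _ → refl) ⟩
          ⟨ p +ᵥ r , q ⟩             ≈⟨ ⟨⟩-+ p r q ⟩
          ⟨ p , q ⟩ + ⟨ r , q ⟩      ≈⟨ +-cong (⊥-sym (proj₂ q∈P⊥ p p∈P)) (sym (+-identityˡ _)) ⟩
          0# + (0# + ⟨ r , q ⟩)      ≈⟨ +-identityˡ _ ⟩
          0# + ⟨ r , q ⟩             ≈⟨ +-congʳ (r⊥P p₀ p₀∈P) ⟨
          ⟨ r , p₀ ⟩ + ⟨ r , q ⟩     ≈⟨ ⟨⟩-+ʳ r p₀ q ⟨
          ⟨ r , p₀ +ᵥ q ⟩            ≈⟨ ⟨⟩-cong (λ _ → refl) w≈ ⟨
          ⟨ r , w ⟩                  ≈⟨ ⟨r,w⟩≈ ⟩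
          ⟨ u , w ⟩ * o              ≈⟨ *-congʳ ⟨u,v⟩≈⟨u,w⟩ ⟨
          ⟨ u , v ⟩ * o              ∎)

        eichler-maps-right-to-w : eichler u v q a v ≈ᵥ w
        eichler-maps-right-to-w i =
          trans (eichler-moves-right a (⟨v,u⟩≉0 huv) (⊥-sym (InP⊥⇒⊥right q∈P⊥)) i) (sym (w≈ i))

      eichler-exchanging-partners :
        ∃[ φ ] (IsRescaledEichler φ × InX φ × φ v ≈ᵥ w × φ u ≈ᵥ u)
      eichler-exchanging-partners with decomposition
      ... | a , q , ia , q∈P⊥ , w≈ =
        eichler u v q a , eich , gen-eich eich ,
        eichler-maps-right-to-w ia q∈P⊥ w≈ ,
        eichler-fixes-left a (HypPair.u-iso huv) (⊥-sym (InP⊥⇒⊥left q∈P⊥))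
        where
        eich : IsRescaledEichler (eichler u v q a)
        eich = eichler-isRescaledEichler huv q∈P⊥ (⟨L,q⟩⊆⟨u,v⟩O ia q∈P⊥ w≈) ia
                 (trace-condition ia q∈P⊥ w≈)

lemma5p6 : ∀ {c ℓ} (S : LocalQuadSetting c ℓ) → Dyadic S → Ramified S →
    let open LocalQuadSetting S
        open Hermitian S
    in ∀ (n m : ℕ) (H : HForm n) (g : Fin m → V n) (v u₁ u₂ : V n) →
    let open HForm H
        open Lattice H g
    in HypPair v u₁ → HypPair v u₂ → ⟨ v , u₁ ⟩ ≈ ⟨ v , u₂ ⟩ →
    ∃[ φ ] (IsRescaledEichler φ × InX φ × φ u₁ ≈ᵥ u₂ × φ v ≈ᵥ v)
lemma5p6 S _ _ n m H g v u₁ u₂ h₁ h₂ ⟨v,u₁⟩≈⟨v,u₂⟩ =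
  EichlerProperties.Pairs.SharedPartner.eichler-exchanging-partners S H g h₁ h₂ ⟨v,u₁⟩≈⟨v,u₂⟩
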